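{- If a graph $G$ has a (2,1)-edge-order (through some edge $rt$ and avoiding some edge $ru$), then $G$ is 3-edge-connected.
   Context: Graphs are finite and undirected and may contain parallel edges and self-loops; cycles may have length one or two. For $k\ge1$, a graph is $k$-edge-connected if it has at least two vertices and no edge-cut of size less than $k$. Let $G=(V,E)$, $n=|V|$, $m=|E|$. An ear decomposition of $G$ is a sequence $(P_0,P_1,\dots,P_k)$ of subgraphs of $G$ that partition $E$ such that (i) $P_0$ is a cycle that is not a self-loop, and (ii) every $P_i$, $1\le i\le k$, is either a path that intersects $P_0\cup\dots\cup P_{i-1}$ exactly in its endpoints, or a cycle that intersects $P_0\cup\dots\cup P_{i-1}$ in exactly one vertex $q_i$ (also called an endpoint of $P_i$). Each $P_i$ is an ear; it is short if it is a single edge and long otherwise. An ear decomposition has $m-n+1$ ears, indexed $0,\dots,m-n$. Let $G_i:=P_0\cup\dots\cup P_i$ with edge set $E_i$, and let $\overline{G_i}$ be the subgraph of $G$ induced by the edge set $E-E_i$. Let $inner(P_i):=V(P_i)-V(G_{i-1})$ (all vertices of $P_0$ are inner). Given distinct edges $rt$ and $ru$ of $G$ ($t=u$ allowed), a (2,1)-edge-order through $rt$ and avoiding $ru$ is an ear decomposition $D=(P_0,\dots,P_{m-n})$ of $G$ such that (1) $rt\in P_0$; (2) $P_{m-n}$ is the short ear $ru$; (3) for every $0\le i<m-n$, $\overline{G_i}$ contains all vertices of $inner(P_i)$ and, if $P_i$ is short, at least one endpoint of $P_i$. -}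

module Defs where

open import Data.Nat using (ℕ; zero; suc; _≤_; _∸_)
open import Data.Fin using (Fin)
open import Data.Bool using (Bool; true; false; _xor_)
open import Data.Product using (_×_; _,_; proj₁; proj₂; ∃; ∃-syntax; Σ)
open import Data.Sum using (_⊎_)
open import Data.Unit using (⊤)
open import Data.Empty using (⊥)
open import Data.Maybe using (Maybe; just; nothing)
open import Data.List using (List; []; _∷_; [_]; _++_; map; concatMap; length; allFin; filterᵇ; last)
open import Data.List.Membership.Propositional using (_∈_; _∉_)
open import Data.List.Relation.Unary.Unique.Propositional using (Unique)
open import Data.List.Relation.Binary.Permutation.Propositional using (_↭_)
open import Relation.Binary.PropositionalEquality using (_≡_; _≢_)

-- Finite undirected multigraphs: vertices Fin n, edges Fin m, each edge
-- has a pair of endpoints (order irrelevant).  Parallel edges and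
-- self-loops are allowed.

record Graph : Set where
  field
    n    : ℕ
    m    : ℕ
    ends : Fin m → Fin n × Fin n
open Graph public

module _ (G : Graph) where

  Joins : Fin (m G) → Fin (n G) → Fin (n G) → Set
  Joins e x y = ends G e ≡ (x , y) ⊎ ends G e ≡ (y , x)

  Incident : Fin (m G) → Fin (n G) → Set
  Incident e v = proj₁ (ends G e) ≡ v ⊎ proj₂ (ends G e) ≡ v

  crossing : (Fin (n G) → Bool) → List (Fin (m G))
  crossing S = filterᵇ (λ e → S (proj₁ (ends G e)) xor S (proj₂ (ends G e))) (allFin (m G))

  EdgeConnected : ℕ → Set
  EdgeConnected k =
    2 ≤ n G ×
    ((S : Fin (n G) → Bool) → (∃[ v ] S v ≡ true) → (∃[ w ] S w ≡ false) →
      k ≤ length (crossing S))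

  -- Ears, given as walks  v₀ e₁ v₁ e₂ … e_k v_k  : a start vertex and a
  -- list of steps (edge, next vertex).

  record Ear : Set where
    constructor ear
    field
      start : Fin (n G)
      steps : List (Fin (m G) × Fin (n G))

  open Ear public

  IsWalk : Fin (n G) → List (Fin (m G) × Fin (n G)) → Set
  IsWalk x []            = ⊤
  IsWalk x ((e , y) ∷ s) = Joins e x y × IsWalk y s

  edgesOf : Ear → List (Fin (m G))
  edgesOf P = map proj₁ (steps P)

  vertsOf : Ear → List (Fin (n G))
  vertsOf P = start P ∷ map proj₂ (steps P)

  dropLast : {A : Set} → List A → List A
  dropLast []           = []
  dropLast (x ∷ [])     = []
  dropLast (x ∷ y ∷ xs) = x ∷ dropLast (y ∷ xs)

  endOf : Ear → Fin (n G)
  endOf (ear s []) = s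
  endOf (ear s (x ∷ xs)) with last (x ∷ xs)
  ... | just (_ , v) = v
  ... | nothing      = s

  midsOf : Ear → List (Fin (n G))
  midsOf P = dropLast (map proj₂ (steps P))

  IsPath : Ear → Set
  IsPath P = 1 ≤ length (steps P) × IsWalk (start P) (steps P) × Unique (vertsOf P)

  -- a cycle v₀ e₁ … e_k v_k = v₀ with k ≥ 1, v₁ … v_k pairwise distinct
  -- and e₁ … e_k pairwise distinct (k = 1: self-loop, k = 2: two
  -- parallel edges)
  IsCycle : Ear → Set
  IsCycle P = last (map proj₂ (steps P)) ≡ just (start P) ×
              IsWalk (start P) (steps P) ×
              Unique (map proj₂ (steps P)) × Unique (edgesOf P)

  Short : Ear → Set
  Short P = length (steps P) ≡ 1

  vertsOfAll : List Ear → List (Fin (n G))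
  vertsOfAll = concatMap vertsOf

  edgesOfAll : List Ear → List (Fin (m G))
  edgesOfAll = concatMap edgesOf

  -- P is a valid ear w.r.t. the previously chosen ears `prev`
  -- (G_{i-1} = union of prev): a path meeting G_{i-1} exactly in its
  -- two endpoints, or a cycle meeting G_{i-1} exactly in its endpoint q_i.
  -- For both, the vertices are start ∷ mids ++ [end] (end = start for
  -- a cycle), so the intersection condition reads uniformly.
  ValidEar : List Ear → Ear → Set
  ValidEar prev P =
    (IsPath P ⊎ IsCycle P) ×
    start P ∈ vertsOfAll prev × endOf P ∈ vertsOfAll prev ×
    ((v : Fin (n G)) → v ∈ midsOf P → v ∉ vertsOfAll prev)

  LaterEars : List Ear → List Ear → Set
  LaterEars prev []       = ⊤
  LaterEars prev (P ∷ Ps) = ValidEar prev P × LaterEars (prev ++ [ P ]) Ps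

  IsEarDecomposition : List Ear → Set
  IsEarDecomposition []       = ⊥
  IsEarDecomposition (P₀ ∷ Ps) =
    edgesOfAll (P₀ ∷ Ps) ↭ allFin (m G) ×
    ((v : Fin (n G)) → v ∈ vertsOfAll (P₀ ∷ Ps)) ×
    IsCycle P₀ × 2 ≤ length (steps P₀) ×
    LaterEars [ P₀ ] Ps

  -- (2,1)-edge-order condition (3).
  -- V(Ḡ_i): vertices incident to some edge not in E_i.
  InComplement : List (Fin (m G)) → Fin (n G) → Set
  InComplement Ei v = ∃[ e ] (e ∉ Ei × Incident e v)

  Cond3 : List Ear → Ear → Set
  Cond3 prev P =
    ((v : Fin (n G)) → v ∈ vertsOf P → v ∉ vertsOfAll prev →
        InComplement (edgesOfAll (prev ++ [ P ])) v) ×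
    (Short P → InComplement (edgesOfAll (prev ++ [ P ])) (start P)
             ⊎ InComplement (edgesOfAll (prev ++ [ P ])) (endOf P))

  -- condition (3) for every ear except the last; condition (2) for the last
  OrderConds : Fin (m G) → List Ear → List Ear → Set
  OrderConds eru prev []           = ⊤
  OrderConds eru prev (P ∷ [])     = Short P × edgesOf P ≡ [ eru ]
  OrderConds eru prev (P ∷ Q ∷ Ps) = Cond3 prev P × OrderConds eru (prev ++ [ P ]) (Q ∷ Ps)

  IsEdgeOrder21 : Fin (m G) → Fin (m G) → List Ear → Set
  IsEdgeOrder21 ert eru []        = IsEarDecomposition []
  IsEdgeOrder21 ert eru (P₀ ∷ Ps) =
    IsEarDecomposition (P₀ ∷ Ps) × ert ∈ edgesOf P₀ × OrderConds eru [] (P₀ ∷ Ps)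

-- Fix a cut δ(S) and call the side of r the near side.  Let P_i be the first ear with a
-- vertex z on the far side.  It is a closed walk (i = 0, and P_0 passes through r) or a walk
-- whose ends lie in the near graph G_{i-1}; either way it visits both sides and returns, so it
-- crosses δ(S) twice.  A third crossing comes later: z is an inner vertex of P_i, so by
-- condition (3) it lies on a later ear.  If u is far, the final ear ru crosses.  Otherwise the
-- last ear with a far vertex is not ru, and condition (3) makes it share a vertex with a later
-- ear, which is entirely near; so that ear crosses δ(S).

module Submission where

open import Defs
open import Data.Fin using (Fin; zero; suc)
open import Data.Nat using (ℕ; zero; suc; _+_; _≤_; z≤n; s≤s)
open import Data.Nat.Properties using (≤-trans; <-irrefl; ≤-reflexive; m≤n+m; m≤m+n; +-mono-≤)
open import Data.Bool using (Bool; true; false; _xor_)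
open import Data.Bool.Properties using (xor-comm; xor-inverseˡ; ¬-not) renaming (_≟_ to _≟ᵇ_)
open import Data.Product using (_×_; _,_; proj₁; proj₂; ∃-syntax)
open import Data.Sum using (_⊎_; inj₁; inj₂; [_,_]′)
open import Data.Empty using (⊥-elim)
open import Data.Maybe using (just)
open import Data.Maybe.Properties using (just-injective)
open import Data.List using (List; []; _∷_; [_]; _++_; map; length; filterᵇ; last)
open import Data.List.Properties using (++-assoc; ++-identityʳ; concatMap-++; filter-++; length-++; length-filter)
open import Data.List.Membership.Propositional using (_∈_; _∉_; find)
open import Data.List.Membership.Propositional.Properties using (∈-++⁺ˡ; ∈-++⁺ʳ; ∈-++⁻; ∈-allFin)
open import Data.List.Relation.Unary.Any using (here; there)
open import Data.List.Relation.Unary.All using (All; []; _∷_; all?) renaming (lookup to All-lookup)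
open import Data.List.Relation.Unary.All.Properties using (++⁺)
open import Data.List.Relation.Unary.All.Properties.Core using (¬All⇒Any¬)
open import Data.List.Relation.Unary.AllPairs using (_∷_)
open import Data.List.Relation.Unary.Unique.Propositional using (Unique)
open import Data.List.Relation.Binary.Permutation.Propositional using (_↭_; ↭-sym)
open import Data.List.Relation.Binary.Permutation.Propositional.Properties using (∈-resp-↭; filter-↭; ↭-length)
open import Relation.Binary.PropositionalEquality using (_≡_; _≢_; refl; sym; trans; cong; subst)
open import Relation.Nullary using (¬_; yes; no)
open import Relation.Nullary.Decidable using (T?)

xor-≢ : ∀ {a b} → a ≢ b → a xor b ≡ true
xor-≢ {b = b} a≢b = subst (λ a → a xor b ≡ true) (sym (¬-not a≢b)) (xor-inverseˡ b)

module _ (G : Graph) where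

  private
    Vertex = Fin (n G)
    Edge   = Fin (m G)
    Steps  = List (Edge × Vertex)

  walkEnd : Vertex → Steps → Vertex
  walkEnd x []            = x
  walkEnd x ((_ , y) ∷ s) = walkEnd y s

  walkEnd-∈ : ∀ x s → walkEnd x s ∈ vertsOf G (ear x s)
  walkEnd-∈ x []            = here refl
  walkEnd-∈ x ((_ , y) ∷ s) = there (walkEnd-∈ y s)

  last-steps : ∀ x st s → ∃[ e ] last (st ∷ s) ≡ just (e , walkEnd x (st ∷ s))
  last-steps x (e , y) []        = e , refl
  last-steps x (e , y) (st ∷ s) = last-steps y st s

  endOf≡walkEnd : ∀ x s → endOf G (ear x s) ≡ walkEnd x s
  endOf≡walkEnd x []       = refl
  endOf≡walkEnd x (st ∷ s) with last (st ∷ s) | last-steps x st s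
  ... | just _ | _ , refl = refl

  endOf-∈ : (P : Ear G) → endOf G P ∈ vertsOf G P
  endOf-∈ (ear x s) = subst (_∈ vertsOf G (ear x s)) (sym (endOf≡walkEnd x s)) (walkEnd-∈ x s)

  last-vertex : ∀ x st s → last (map proj₂ (st ∷ s)) ≡ just (walkEnd x (st ∷ s))
  last-vertex x (_ , y) []        = refl
  last-vertex x (_ , y) (st ∷ s) = last-vertex y st s

  closed-walkEnd : ∀ x s → last (map proj₂ s) ≡ just x → walkEnd x s ≡ x
  closed-walkEnd x (st ∷ s) eq = just-injective (trans (sym (last-vertex x st s)) eq)

  Joins⇒Incidentˡ : ∀ {e x y} → Joins G e x y → Incident G e x
  Joins⇒Incidentˡ (inj₁ eq) = inj₁ (cong proj₁ eq)
  Joins⇒Incidentˡ (inj₂ eq) = inj₂ (cong proj₂ eq)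

  Joins⇒Incidentʳ : ∀ {e x y} → Joins G e x y → Incident G e y
  Joins⇒Incidentʳ (inj₁ eq) = inj₂ (cong proj₂ eq)
  Joins⇒Incidentʳ (inj₂ eq) = inj₁ (cong proj₁ eq)

  Incident⇒end : ∀ {e x y v} → Joins G e x y → Incident G e v → v ≡ x ⊎ v ≡ y
  Incident⇒end (inj₁ eq) (inj₁ i) = inj₁ (trans (sym i) (cong proj₁ eq))
  Incident⇒end (inj₁ eq) (inj₂ i) = inj₂ (trans (sym i) (cong proj₂ eq))
  Incident⇒end (inj₂ eq) (inj₁ i) = inj₂ (trans (sym i) (cong proj₁ eq))
  Incident⇒end (inj₂ eq) (inj₂ i) = inj₁ (trans (sym i) (cong proj₂ eq))

  Incident-walk : ∀ {x s e v} → IsWalk G x s → e ∈ edgesOf G (ear x s) → Incident G e v →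
                  v ∈ vertsOf G (ear x s)
  Incident-walk {s = (_ , y) ∷ s} (xy , _) (here refl) inc with Incident⇒end xy inc
  ... | inj₁ refl = here refl
  ... | inj₂ refl = there (here refl)
  Incident-walk {s = _ ∷ s} (_ , walk) (there e∈) inc = there (Incident-walk walk e∈ inc)

  ear-walk : ∀ {P} → IsPath G P ⊎ IsCycle G P → IsWalk G (start P) (steps P)
  ear-walk (inj₁ (_ , walk , _)) = walk
  ear-walk (inj₂ (_ , walk , _)) = walk

  Incident-ears : ∀ {prev Qs e v} → LaterEars G prev Qs → e ∈ edgesOfAll G Qs → Incident G e v →
                  v ∈ vertsOfAll G Qs
  Incident-ears {Qs = Q ∷ Qs} ((shape , _) , later) e∈ inc with ∈-++⁻ (edgesOf G Q) e∈
  ... | inj₁ e∈Q      = ∈-++⁺ˡ (Incident-walk (ear-walk shape) e∈Q inc)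
  ... | inj₂ e∈later = ∈-++⁺ʳ (vertsOf G Q) (Incident-ears later e∈later inc)

  short-or-inner : ∀ {P} → IsPath G P ⊎ IsCycle G P →
                   Short G P ⊎ ∃[ v ] v ∈ midsOf G P × v ∈ vertsOf G P
  short-or-inner {ear _ []}                    (inj₁ (() , _))
  short-or-inner {ear _ []}                    (inj₂ (() , _))
  short-or-inner {ear _ (_ ∷ [])}              _ = inj₁ refl
  short-or-inner {ear _ ((_ , y) ∷ _ ∷ _)} _ = inj₂ (y , here refl , there (here refl))

module Cut (G : Graph) (S : Fin (n G) → Bool) where

  private
    Edge = Fin (m G)

  Crosses : Edge → Bool
  Crosses e = S (proj₁ (ends G e)) xor S (proj₂ (ends G e))

  crossings : List Edge → ℕ
  crossings es = length (filterᵇ Crosses es)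

  crossings-++ : ∀ xs ys → crossings (xs ++ ys) ≡ crossings xs + crossings ys
  crossings-++ xs ys =
    trans (cong length (filter-++ (λ e → T? (Crosses e)) xs ys)) (length-++ (filterᵇ Crosses xs))

  crossings-↭ : ∀ {xs ys} → xs ↭ ys → crossings xs ≡ crossings ys
  crossings-↭ xs↭ys = ↭-length (filter-↭ (λ e → T? (Crosses e)) xs↭ys)

  crossings-≤-length : ∀ es → crossings es ≤ length es
  crossings-≤-length = length-filter (λ e → T? (Crosses e))

  crossings-∷ : ∀ e es → crossings es ≤ crossings (e ∷ es)
  crossings-∷ e es = subst (crossings es ≤_) (sym (crossings-++ [ e ] es)) (m≤n+m _ _)

  Joins-Crosses : ∀ {e x y} → Joins G e x y → S x ≢ S y → Crosses e ≡ true
  Joins-Crosses (inj₁ refl) x≢y = xor-≢ x≢y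
  Joins-Crosses {x = x} {y} (inj₂ refl) x≢y = trans (xor-comm (S y) (S x)) (xor-≢ x≢y)

  crossings-∷-crossing : ∀ {e es} → Crosses e ≡ true → suc (crossings es) ≤ crossings (e ∷ es)
  crossings-∷-crossing {e} {es} crosses rewrite crosses = ≤-reflexive refl

  other-side : ∀ {v w} y → S v ≡ true → S w ≡ false → S v ≢ S y ⊎ S w ≢ S y
  other-side {v} y v≡true w≡false with S v ≟ᵇ S y
  ... | no v≢y  = inj₁ v≢y
  ... | yes v≡y =
    inj₂ (λ w≡y → true≢false (trans (sym v≡true) (trans v≡y (trans (sym w≡y) w≡false))))
    where
    true≢false : true ≢ false
    true≢false ()

  walk-crossing : ∀ {x s w} → IsWalk G x s → w ∈ vertsOf G (ear x s) → S w ≢ S x →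
                  1 ≤ crossings (edgesOf G (ear x s))
  walk-crossing {s = []} _ (here refl) w≢x = ⊥-elim (w≢x refl)
  walk-crossing {x} {(e , y) ∷ s} (xy , walk) w∈ w≢x with S x ≟ᵇ S y | w∈
  ... | no x≢y  | _         = ≤-trans (s≤s z≤n) (crossings-∷-crossing (Joins-Crosses xy x≢y))
  ... | yes _   | here refl = ⊥-elim (w≢x refl)
  ... | yes x≡y | there w∈′ =
    ≤-trans (walk-crossing walk w∈′ (λ w≡y → w≢x (trans w≡y (sym x≡y)))) (crossings-∷ e _)

  walk-crossing-between : ∀ {x s v w} → IsWalk G x s →
                          v ∈ vertsOf G (ear x s) → w ∈ vertsOf G (ear x s) → S v ≢ S w →
                          1 ≤ crossings (edgesOf G (ear x s))
  walk-crossing-between {x} {v = v} walk v∈ w∈ v≢w with S v ≟ᵇ S x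
  ... | yes v≡x = walk-crossing walk w∈ (λ w≡x → v≢w (trans v≡x (sym w≡x)))
  ... | no v≢x  = walk-crossing walk v∈ v≢x

  walk-crossings-twice : ∀ {x s w} → IsWalk G x s → w ∈ vertsOf G (ear x s) → S w ≢ S x →
                         S (walkEnd G x s) ≡ S x → 2 ≤ crossings (edgesOf G (ear x s))
  walk-crossings-twice {s = []} _ (here refl) w≢x _ = ⊥-elim (w≢x refl)
  walk-crossings-twice {x} {(e , y) ∷ s} (xy , walk) w∈ w≢x end≡x with S x ≟ᵇ S y | w∈
  ... | no x≢y  | _         =
    ≤-trans (s≤s (walk-crossing walk (walkEnd-∈ G y s) (λ end≡y → x≢y (trans (sym end≡x) end≡y))))
            (crossings-∷-crossing (Joins-Crosses xy x≢y))
  ... | yes _   | here refl = ⊥-elim (w≢x refl)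
  ... | yes x≡y | there w∈′ =
    ≤-trans (walk-crossings-twice walk w∈′ (λ w≡y → w≢x (trans w≡y (sym x≡y))) (trans end≡x x≡y))
            (crossings-∷ e _)

module EdgeOrder (G : Graph) (S : Fin (n G) → Bool)
                 (eru : Fin (m G)) (r u : Fin (n G)) (ru : Joins G eru r u) where

  open Cut G S

  earCrossings : List (Ear G) → ℕ
  earCrossings Qs = crossings (edgesOfAll G Qs)

  earCrossings-∷ : ∀ Q Qs → earCrossings (Q ∷ Qs) ≡ crossings (edgesOf G Q) + earCrossings Qs
  earCrossings-∷ Q Qs = crossings-++ (edgesOf G Q) (edgesOfAll G Qs)

  earCrossings-head : ∀ Q Qs → crossings (edgesOf G Q) ≤ earCrossings (Q ∷ Qs)
  earCrossings-head Q Qs = subst (_ ≤_) (sym (earCrossings-∷ Q Qs)) (m≤m+n _ _)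

  earCrossings-tail : ∀ Q Qs → earCrossings Qs ≤ earCrossings (Q ∷ Qs)
  earCrossings-tail Q Qs = subst (_ ≤_) (sym (earCrossings-∷ Q Qs)) (m≤n+m _ _)

  earCrossings-split : ∀ {a b} Q Qs → a ≤ crossings (edgesOf G Q) → b ≤ earCrossings Qs →
                       a + b ≤ earCrossings (Q ∷ Qs)
  earCrossings-split Q Qs a≤ b≤ = subst (_ ≤_) (sym (earCrossings-∷ Q Qs)) (+-mono-≤ a≤ b≤)

  -- What is left of a (2,1)-edge-order avoiding eru once the ears prev have been placed.
  record Suffix (prev Qs : List (Ear G)) : Set where
    constructor suffix
    field
      attached : LaterEars G prev Qs
      ordered  : OrderConds G eru prev Qs
      covering : ∀ e → e ∈ edgesOfAll G (prev ++ Qs)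

  Suffix-tail : ∀ {prev Q Q′ Qs} → Suffix prev (Q ∷ Q′ ∷ Qs) → Suffix (prev ++ [ Q ]) (Q′ ∷ Qs)
  Suffix-tail {prev} {Q} {Q′} {Qs} (suffix (_ , attached) (_ , ordered) covering) =
    suffix attached ordered
      (λ e → subst (λ Ps → e ∈ edgesOfAll G Ps) (sym (++-assoc prev [ Q ] (Q′ ∷ Qs))) (covering e))

  head-walk : ∀ {prev Q Qs} → Suffix prev (Q ∷ Qs) → IsWalk G (start Q) (steps Q)
  head-walk sfx = ear-walk G (proj₁ (proj₁ (Suffix.attached sfx)))

  InComplement-later : ∀ {Ps Qs v} → Suffix Ps Qs → InComplement G (edgesOfAll G Ps) v →
                       v ∈ vertsOfAll G Qs
  InComplement-later {Ps} {Qs} (suffix attached _ covering) (e , e∉ , inc)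
    with ∈-++⁻ (edgesOfAll G Ps) (subst (e ∈_) (concatMap-++ (edgesOf G) Ps Qs) (covering e))
  ... | inj₁ e∈Ps = ⊥-elim (e∉ e∈Ps)
  ... | inj₂ e∈Qs = Incident-ears G attached e∈Qs inc

  new-vertex-later : ∀ {prev Q Qs v} → Cond3 G prev Q → Suffix (prev ++ [ Q ]) Qs →
                     v ∈ vertsOf G Q → v ∉ vertsOfAll G prev → v ∈ vertsOfAll G Qs
  new-vertex-later (new , _) sfx v∈ v∉ = InComplement-later sfx (new _ v∈ v∉)

  ear-meets-later : ∀ {prev Q Q′ Qs} → Suffix prev (Q ∷ Q′ ∷ Qs) →
                    ∃[ v ] v ∈ vertsOf G Q × v ∈ vertsOfAll G (Q′ ∷ Qs)
  ear-meets-later {Q = Q} sfx@(suffix ((shape , _ , _ , mids∉) , _) (cond3 , _) _)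
    with short-or-inner G shape
  ... | inj₁ short = [ (λ inc → start Q , here refl , InComplement-later (Suffix-tail sfx) inc)
                     , (λ inc → endOf G Q , endOf-∈ G Q , InComplement-later (Suffix-tail sfx) inc)
                     ]′ (proj₂ cond3 short)
  ... | inj₂ (v , v∈mids , v∈) = v , v∈ , new-vertex-later cond3 (Suffix-tail sfx) v∈ (mids∉ v v∈mids)

  last-ear-vertices : ∀ {prev Q v} → Suffix prev [ Q ] → v ∈ vertsOf G Q → v ≡ r ⊎ v ≡ u
  last-ear-vertices {Q = ear _ (_ ∷ [])} sfx@(suffix _ (_ , refl) _) (here refl) =
    Incident⇒end G ru (Joins⇒Incidentˡ G (proj₁ (head-walk sfx)))
  last-ear-vertices {Q = ear _ (_ ∷ [])} sfx@(suffix _ (_ , refl) _) (there (here refl)) =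
    Incident⇒end G ru (Joins⇒Incidentʳ G (proj₁ (head-walk sfx)))

  last-edge-crossing : ∀ {prev Q Qs} → Suffix prev (Q ∷ Qs) → S r ≢ S u → 1 ≤ earCrossings (Q ∷ Qs)
  last-edge-crossing {Q = Q} {[]} (suffix _ (_ , edges≡) _) r≢u =
    ≤-trans (subst (λ es → 1 ≤ crossings es) (sym edges≡) (crossings-∷-crossing (Joins-Crosses ru r≢u)))
            (earCrossings-head Q [])
  last-edge-crossing {Q = Q} {Q′ ∷ Qs} sfx r≢u =
    ≤-trans (last-edge-crossing (Suffix-tail sfx) r≢u) (earCrossings-tail Q (Q′ ∷ Qs))

  crossing-or-passes-on : ∀ {prev Q Q′ Qs x} → Suffix prev (Q ∷ Q′ ∷ Qs) →
                          x ∈ vertsOfAll G (Q ∷ Q′ ∷ Qs) → S x ≢ S r →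
                          1 ≤ crossings (edgesOf G Q) ⊎ ∃[ y ] y ∈ vertsOfAll G (Q′ ∷ Qs) × S y ≢ S r
  crossing-or-passes-on {Q = Q} sfx x∈ x≢r with ∈-++⁻ (vertsOf G Q) x∈ | ear-meets-later sfx
  ... | inj₂ x∈later | _ = inj₂ (_ , x∈later , x≢r)
  ... | inj₁ x∈Q | y , y∈Q , y∈later with S y ≟ᵇ S r
  ...   | no y≢r  = inj₂ (y , y∈later , y≢r)
  ...   | yes y≡r = inj₁ (walk-crossing-between (head-walk sfx) x∈Q y∈Q (λ x≡y → x≢r (trans x≡y y≡r)))

  later-crossing-same-side : ∀ {prev Q Qs x} → S u ≡ S r → Suffix prev (Q ∷ Qs) →
                             x ∈ vertsOfAll G (Q ∷ Qs) → S x ≢ S r → 1 ≤ earCrossings (Q ∷ Qs)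
  later-crossing-same-side {Q = Q} {[]} {x} u≡r sfx x∈ x≢r
    with last-ear-vertices sfx (subst (x ∈_) (++-identityʳ (vertsOf G Q)) x∈)
  ... | inj₁ refl = ⊥-elim (x≢r refl)
  ... | inj₂ refl = ⊥-elim (x≢r u≡r)
  later-crossing-same-side {Q = Q} {Q′ ∷ Qs} u≡r sfx x∈ x≢r with crossing-or-passes-on sfx x∈ x≢r
  ... | inj₁ crossing            = ≤-trans crossing (earCrossings-head Q (Q′ ∷ Qs))
  ... | inj₂ (_ , y∈later , y≢r) =
    ≤-trans (later-crossing-same-side u≡r (Suffix-tail sfx) y∈later y≢r)
            (earCrossings-tail Q (Q′ ∷ Qs))

  later-crossing : ∀ {prev Qs x} → Suffix prev Qs → x ∈ vertsOfAll G Qs → S x ≢ S r →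
                   1 ≤ earCrossings Qs
  later-crossing {Qs = _ ∷ _} sfx x∈ x≢r with S u ≟ᵇ S r
  ... | yes u≡r = later-crossing-same-side u≡r sfx x∈ x≢r
  ... | no u≢r  = last-edge-crossing sfx (λ r≡u → u≢r (sym r≡u))

  last-ear-crossings : ∀ {prev Q} → Suffix prev [ Q ] → crossings (edgesOf G Q) ≤ 1
  last-ear-crossings (suffix _ (_ , edges≡) _) =
    subst (λ es → crossings es ≤ 1) (sym edges≡) (crossings-≤-length [ eru ])

  OnRSide : List (Fin (n G)) → Set
  OnRSide = All (λ v → S v ≡ S r)

  off-r-side : ∀ vs → ¬ OnRSide vs → ∃[ z ] z ∈ vs × S z ≢ S r
  off-r-side vs ¬onR = find (¬All⇒Any¬ (λ v → S v ≟ᵇ S r) vs ¬onR)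

  bicoloured-ear-crossings : ∀ {prev Q Qs z} → Suffix prev (Q ∷ Qs) → OnRSide (vertsOfAll G prev) →
                             z ∈ vertsOf G Q → S z ≢ S r → 3 ≤ earCrossings (Q ∷ Qs)
  bicoloured-ear-crossings {prev} {Q} {Qs} sfx@(suffix ((_ , start∈ , end∈ , _) , _) _ _) onR z∈ z≢r =
    earCrossings-split Q Qs twice (once Qs sfx)
    where
    start≡r : S (start Q) ≡ S r
    start≡r = All-lookup onR start∈
    end≡r : S (walkEnd G (start Q) (steps Q)) ≡ S r
    end≡r = subst (λ v → S v ≡ S r) (endOf≡walkEnd G (start Q) (steps Q)) (All-lookup onR end∈)
    twice : 2 ≤ crossings (edgesOf G Q)
    twice = walk-crossings-twice (head-walk sfx) z∈ (λ z≡start → z≢r (trans z≡start start≡r))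
                                 (trans end≡r (sym start≡r))
    once : ∀ Qs → Suffix prev (Q ∷ Qs) → 1 ≤ earCrossings Qs
    once []      sfx′ = ⊥-elim (<-irrefl refl (≤-trans twice (last-ear-crossings sfx′)))
    once (_ ∷ _) sfx′ =
      later-crossing (Suffix-tail sfx′)
        (new-vertex-later (proj₁ (Suffix.ordered sfx′)) (Suffix-tail sfx′) z∈
                          (λ z∈prev → z≢r (All-lookup onR z∈prev)))
        z≢r

  OnRSide-++ : ∀ prev Q → OnRSide (vertsOfAll G prev) → OnRSide (vertsOf G Q) →
               OnRSide (vertsOfAll G (prev ++ [ Q ]))
  OnRSide-++ prev Q onR onRQ =
    subst OnRSide (sym (concatMap-++ (vertsOf G) prev [ Q ])) (++⁺ onR (++⁺ onRQ []))

  three-crossings : ∀ {prev Q Qs x} → Suffix prev (Q ∷ Qs) → OnRSide (vertsOfAll G prev) →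
                    x ∈ vertsOfAll G (Q ∷ Qs) → S x ≢ S r → 3 ≤ earCrossings (Q ∷ Qs)
  three-crossings {Q = Q} {[]} {x} sfx onR x∈ x≢r =
    bicoloured-ear-crossings sfx onR (subst (x ∈_) (++-identityʳ (vertsOf G Q)) x∈) x≢r
  three-crossings {prev} {Q} {Q′ ∷ Qs} sfx onR x∈ x≢r with ∈-++⁻ (vertsOf G Q) x∈
  ... | inj₁ x∈Q     = bicoloured-ear-crossings sfx onR x∈Q x≢r
  ... | inj₂ x∈later with all? (λ v → S v ≟ᵇ S r) (vertsOf G Q)
  ...   | no ¬onRQ =
    let z , z∈ , z≢r = off-r-side (vertsOf G Q) ¬onRQ
    in  bicoloured-ear-crossings sfx onR z∈ z≢r
  ...   | yes onRQ =
    ≤-trans (three-crossings (Suffix-tail sfx) (OnRSide-++ prev Q onR onRQ) x∈later x≢r)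
            (earCrossings-tail Q (Q′ ∷ Qs))

  bicoloured-cycle-crossings : ∀ {P₀ Ps z} → IsCycle G P₀ → Cond3 G [] P₀ → Suffix [ P₀ ] Ps →
                               r ∈ vertsOf G P₀ → z ∈ vertsOf G P₀ → S z ≢ S r →
                               3 ≤ earCrossings (P₀ ∷ Ps)
  bicoloured-cycle-crossings {P₀} {Ps} cycle@(closed , walk , _) cond3 sfx r∈ z∈ z≢r =
    earCrossings-split P₀ Ps twice
      (later-crossing sfx (new-vertex-later {prev = []} cond3 sfx z∈ (λ ())) z≢r)
    where
    end≡start : S (walkEnd G (start P₀) (steps P₀)) ≡ S (start P₀)
    end≡start = cong S (closed-walkEnd G (start P₀) (steps P₀) closed)
    twice : 2 ≤ crossings (edgesOf G P₀)
    twice with S (start P₀) ≟ᵇ S r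
    ... | yes start≡r =
      walk-crossings-twice walk z∈ (λ z≡start → z≢r (trans z≡start start≡r)) end≡start
    ... | no start≢r  =
      walk-crossings-twice walk r∈ (λ r≡start → start≢r (sym r≡start)) end≡start

  cut-crossings : ∀ {P₀ Q Qs x} → IsCycle G P₀ → Cond3 G [] P₀ → Suffix [ P₀ ] (Q ∷ Qs) →
                  r ∈ vertsOf G P₀ → x ∈ vertsOfAll G (P₀ ∷ Q ∷ Qs) → S x ≢ S r →
                  3 ≤ earCrossings (P₀ ∷ Q ∷ Qs)
  cut-crossings {P₀} {Q} {Qs} cycle cond3 sfx r∈ x∈ x≢r with ∈-++⁻ (vertsOf G P₀) x∈
  ... | inj₁ x∈P₀    = bicoloured-cycle-crossings cycle cond3 sfx r∈ x∈P₀ x≢r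
  ... | inj₂ x∈later with all? (λ v → S v ≟ᵇ S r) (vertsOf G P₀)
  ...   | no ¬onR =
    let z , z∈ , z≢r = off-r-side (vertsOf G P₀) ¬onR
    in  bicoloured-cycle-crossings cycle cond3 sfx r∈ z∈ z≢r
  ...   | yes onR =
    ≤-trans (three-crossings sfx (++⁺ onR []) x∈later x≢r) (earCrossings-tail P₀ (Q ∷ Qs))

two-distinct : ∀ {k} {x y : Fin k} → x ≢ y → 2 ≤ k
two-distinct {suc zero}    {zero} {zero} x≢y = ⊥-elim (x≢y refl)
two-distinct {suc (suc k)}                _   = s≤s (s≤s z≤n)

lemma3 : (G : Graph) (r t u : Fin (n G)) (ert eru : Fin (m G)) →
         ert ≢ eru → Joins G ert r t → Joins G eru r u →
         (D : List (Ear G)) → IsEdgeOrder21 G ert eru D →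
         EdgeConnected G 3
lemma3 G r t u ert eru _ rt ru (P₀ ∷ []) ((_ , _ , _ , long , _) , _ , short , _) =
  ⊥-elim (<-irrefl refl (subst (2 ≤_) short long))
lemma3 G r t u ert eru _ rt ru (P₀ ∷ Q ∷ Qs)
       ((perm , covers , cycle@(_ , walk , distinct , _) , long , attached) , ert∈ , cond3 , ordered) =
  two-vertices (steps P₀) long distinct , cut
  where
  two-vertices : ∀ st → 2 ≤ length st → Unique (map proj₂ st) → 2 ≤ n G
  two-vertices (_ ∷ [])    (s≤s ())
  two-vertices (_ ∷ _ ∷ _) _        ((y₁≢y₂ ∷ _) ∷ _) = two-distinct y₁≢y₂

  r∈ : r ∈ vertsOf G P₀
  r∈ = Incident-walk G walk ert∈ (Joins⇒Incidentˡ G rt)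

  cut : (S : Fin (n G) → Bool) → ∃[ v ] S v ≡ true → ∃[ w ] S w ≡ false → 3 ≤ length (crossing G S)
  cut S (v , v≡true) (w , w≡false) =
    subst (3 ≤_) (crossings-↭ perm)
      ([ cut-crossings cycle cond3 sfx r∈ (covers v)
       , cut-crossings cycle cond3 sfx r∈ (covers w)
       ]′ (other-side r v≡true w≡false))
    where
    open Cut G S
    open EdgeOrder G S eru r u ru

    sfx : Suffix [ P₀ ] (Q ∷ Qs)
    sfx = suffix attached ordered (λ e → ∈-resp-↭ (↭-sym perm) (∈-allFin e))
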